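{- (a) For all even $n\geq 2$, $d(n)-d(n-2)=2^{\mathrm{val}_2(n)+1}-2$. (b) For all $n\geq 2$, $d(n)=2\big(d(\lfloor n/2\rfloor)+\lfloor n/2\rfloor\big)$. (c) If $n=\sum_i a_i2^i$ is the binary representation of $n\ge1$ (with $a_i\in\{0,1\}$), then $d(n)=\sum_i i\,a_i2^i$.
   Context: $\mathcal B(m)$ is the set of binary partitions of $m$ (all parts powers of $2$) and $m_\lambda(i)$ the number of parts of $\lambda$ equal to $i$. For $m\ge1$ and $\lambda\in\mathcal B(m)$ let $h_{\mathcal B,\lambda}(x)=\prod_{i=0}^{\lfloor\log_2 m\rfloor}(1+x^{2^i})^{\lfloor m/2^i\rfloor-m_\lambda(2^i)}$ and $\mathrm{num}_{\mathcal B}(m,x)=\sum_{\lambda\in\mathcal B(m)}h_{\mathcal B,\lambda}(x)$; set $\mathrm{num}_{\mathcal B}(0,x)=1$. Let $d(m)=\deg\mathrm{num}_{\mathcal B}(m,x)$ (so $d(0)=0$). $\mathrm{val}_2$ is the $2$-adic valuation. -}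

module Defs where

import Data.Nat
open import Data.Nat using (ℕ; zero; suc; _+_; _*_; _∸_; _^_; _≟_)
open import Data.Nat.DivMod using (_/_; _%_)
open import Data.Nat.Logarithm using (⌊log₂_⌋)
open import Data.Bool using (Bool; true; false; if_then_else_; _∧_)
open import Data.List using (List; []; _∷_; [_]; _++_; map; concatMap; upTo; foldr; replicate)
open import Relation.Nullary.Decidable using (⌊_⌋)
open import Data.Nat.Properties using (m^n≢0)

_/2^_ : ℕ → ℕ → ℕ
r /2^ k = _/_ r (2 ^ k) {{m^n≢0 2 k}}

-- Polynomials with natural-number coefficients, as little-endian coefficient lists
Poly : Set
Poly = List ℕ

infixl 6 _⊕_
infixl 7 _⊗_

_⊕_ : Poly → Poly → Poly
[] ⊕ q = q
(a ∷ p) ⊕ [] = a ∷ p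
(a ∷ p) ⊕ (b ∷ q) = (a + b) ∷ (p ⊕ q)

scale : ℕ → Poly → Poly
scale a = map (a *_)

_⊗_ : Poly → Poly → Poly
[] ⊗ q = []
(a ∷ p) ⊗ q = scale a q ⊕ (0 ∷ (p ⊗ q))

pow : Poly → ℕ → Poly
pow p zero = [ 1 ]
pow p (suc e) = p ⊗ pow p e

xpow : ℕ → Poly
xpow k = replicate k 0 ++ [ 1 ]

isZeroPoly : Poly → Bool
isZeroPoly [] = true
isZeroPoly (a ∷ p) = ⌊ a ≟ 0 ⌋ ∧ isZeroPoly p

-- degree (largest index of a nonzero coefficient; 0 for the zero polynomial)
deg : Poly → ℕ
deg [] = 0
deg (a ∷ p) = if isZeroPoly p then 0 else suc (deg p)

-- Binary partitions of r using parts 2^0, ..., 2^k, encoded by their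
-- multiplicity lists [m(2^0), ..., m(2^k)] (position i = multiplicity of 2^i).
bp : ℕ → ℕ → List (List ℕ)
bp zero r = [ r ∷ [] ]
bp (suc k) r =
  concatMap (λ c → map (_++ [ c ]) (bp k (r ∸ c * 2 ^ suc k)))
            (upTo (suc (r /2^ suc k)))

-- 𝓑(m): binary partitions of m (all parts are ≤ m, hence ≤ 2^⌊log₂ m⌋)
𝓑 : ℕ → List (List ℕ)
𝓑 m = bp ⌊log₂ m ⌋ m

mult : List ℕ → ℕ → ℕ
mult [] i = 0
mult (c ∷ cs) zero = c
mult (c ∷ cs) (suc i) = mult cs i

prodUpTo : ℕ → (ℕ → Poly) → Poly
prodUpTo K f = foldr (λ i acc → f i ⊗ acc) [ 1 ] (upTo (suc K))

h𝓑 : ℕ → List ℕ → Poly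
h𝓑 m λ′ = prodUpTo ⌊log₂ m ⌋
  (λ i → pow ([ 1 ] ⊕ xpow (2 ^ i)) (m /2^ i ∸ mult λ′ i))

num𝓑 : ℕ → Poly
num𝓑 zero = [ 1 ]
num𝓑 (suc m) = foldr _⊕_ [] (map (h𝓑 (suc m)) (𝓑 (suc m)))

d : ℕ → ℕ
d m = deg (num𝓑 m)

-- 2-adic valuation (val₂ 0 = 0 by convention; only used for n ≥ 1)
val₂-aux : ℕ → ℕ → ℕ
val₂-aux zero n = 0
val₂-aux (suc f) zero = 0
val₂-aux (suc f) (suc n) =
  if ⌊ suc n % 2 ≟ 0 ⌋ then suc (val₂-aux f (suc n / 2)) else 0

val₂ : ℕ → ℕ
val₂ n = val₂-aux n n

bit : ℕ → ℕ → ℕ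
bit n i = (n /2^ i) % 2

sumBelow : ℕ → (ℕ → ℕ) → ℕ
sumBelow zero f = 0
sumBelow (suc k) f = sumBelow k f + f k

{-# OPTIONS --safe #-}
-- The coefficients are natural numbers, so no cancellation ever happens: a product of
-- polynomials has the sum of their degrees and a sum has the largest degree.  Hence h_{B,λ}
-- has degree  Σ_i (⌊m/2^i⌋ - m_λ(2^i)) 2^i = F(m) - m  where F(m) = Σ_i ⌊m/2^i⌋ 2^i, the same
-- for every λ ∈ B(m), and d(m) = F(m) - m for m ≥ 1.
-- Since F(m) = m + 2 F(⌊m/2⌋) for m ≥ 2, this gives (b), which holds for every n because
-- d(0) = d(1) = 0.  Unfolding (b) along the binary digits of n gives (c), and (a) follows
-- from (b) by induction on the binary representation, using d(2j + 1) = d(2j).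
module Submission where

open import Defs
open import Data.Nat
open import Data.Nat.Properties
open import Data.Nat.Divisibility using (_∣_; divides)
open import Data.Nat.DivMod using (n/1≡n; m/n*n≤m; m*n/n≡m; m/n/o≡m/[n*o]; m/n≡1+[m∸n]/n; /-monoˡ-≤; m<n*o⇒m/o<n; m≡m%n+[m/n]*n; m*n%n≡0; [m+kn]%n≡m%n; m/n<m; m≥n⇒m/n>0)
open import Data.Nat.Logarithm using (⌊log₂_⌋; ⌊log₂⌊n/2⌋⌋≡⌊log₂n⌋∸1; ⌊log₂⌋-mono-≤)
open import Data.Nat.Binary using (zero; 2[1+_]; 1+[2_]; toℕ; fromℕ)
open import Data.Nat.Binary.Properties using (toℕ-fromℕ)
open import Data.Nat.Tactic.RingSolver using (solve-∀)
open import Algebra.Properties.CommutativeSemigroup +-commutativeSemigroup using () renaming (interchange to +-interchange)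
open import Algebra.Properties.CommutativeSemigroup *-commutativeSemigroup using (x∙yz≈y∙xz)
open import Data.Bool using (true; false; if_then_else_)
open import Data.Empty using (⊥-elim)
open import Data.List using (List; []; _∷_; [_]; _++_; map; foldr; length; applyUpTo)
open import Data.List.Properties using (length-++)
open import Data.List.Relation.Unary.All using (All; []; _∷_)
open import Data.List.Relation.Unary.All.Properties using (map⁺; gmap⁺; concat⁺; applyUpTo⁺₁)
open import Data.Product using (_×_; _,_)
open import Data.Sum using (inj₁; inj₂)
open import Function using (_∘_; id)
open import Relation.Nullary.Decidable using (⌊_⌋)
open import Relation.Binary.PropositionalEquality
  using (_≡_; _≢_; refl; cong; cong₂; sym; trans; subst; module ≡-Reasoning)

data AllZero : Poly → Set where
  []   : AllZero []
  0∷_  : ∀ {p} → AllZero p → AllZero (0 ∷ p)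

data HasDegree : Poly → ℕ → Set where
  lead : ∀ {a p} → AllZero p → HasDegree (suc a ∷ p) 0
  _∷_  : ∀ {p n} a → HasDegree p n → HasDegree (a ∷ p) (suc n)

data DegreeAtMost : Poly → ℕ → Set where
  []   : ∀ {n} → DegreeAtMost [] n
  lead : ∀ {a p} → AllZero p → DegreeAtMost (a ∷ p) 0
  _∷_  : ∀ {p n} a → DegreeAtMost p n → DegreeAtMost (a ∷ p) (suc n)

AllZero⇒isZeroPoly : ∀ {p} → AllZero p → isZeroPoly p ≡ true
AllZero⇒isZeroPoly []      = refl
AllZero⇒isZeroPoly (0∷ zs) = AllZero⇒isZeroPoly zs

HasDegree⇒¬isZeroPoly : ∀ {p n} → HasDegree p n → isZeroPoly p ≡ false
HasDegree⇒¬isZeroPoly (lead _)     = refl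
HasDegree⇒¬isZeroPoly (zero  ∷ hd) = HasDegree⇒¬isZeroPoly hd
HasDegree⇒¬isZeroPoly (suc _ ∷ _)  = refl

HasDegree⇒deg≡ : ∀ {p n} → HasDegree p n → deg p ≡ n
HasDegree⇒deg≡ (lead zs) rewrite AllZero⇒isZeroPoly zs   = refl
HasDegree⇒deg≡ (_ ∷ hd)  rewrite HasDegree⇒¬isZeroPoly hd = cong suc (HasDegree⇒deg≡ hd)

⊕-identityʳ : ∀ p → p ⊕ [] ≡ p
⊕-identityʳ []      = refl
⊕-identityʳ (_ ∷ _) = refl

⊕-comm : ∀ p q → p ⊕ q ≡ q ⊕ p
⊕-comm []      q       = sym (⊕-identityʳ q)
⊕-comm (a ∷ p) []      = refl
⊕-comm (a ∷ p) (b ∷ q) = cong₂ _∷_ (+-comm a b) (⊕-comm p q)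

AllZero-⊕ : ∀ {p q} → AllZero p → AllZero q → AllZero (p ⊕ q)
AllZero-⊕ []      zq       = zq
AllZero-⊕ (0∷ zp) []       = 0∷ zp
AllZero-⊕ (0∷ zp) (0∷ zq)  = 0∷ AllZero-⊕ zp zq

AllZero-scale : ∀ c {p} → AllZero p → AllZero (scale c p)
AllZero-scale c []      = []
AllZero-scale c (0∷ zp) rewrite *-zeroʳ c = 0∷ AllZero-scale c zp

AllZero-scale0 : ∀ p → AllZero (scale 0 p)
AllZero-scale0 []      = []
AllZero-scale0 (_ ∷ p) = 0∷ AllZero-scale0 p

AllZero-⊗ˡ : ∀ {p} q → AllZero p → AllZero (p ⊗ q)
AllZero-⊗ˡ q []      = []
AllZero-⊗ˡ q (0∷ zp) = AllZero-⊕ (AllZero-scale0 q) (0∷ AllZero-⊗ˡ q zp)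

AllZero⇒DegreeAtMost : ∀ {p n} → AllZero p → DegreeAtMost p n
AllZero⇒DegreeAtMost             []      = []
AllZero⇒DegreeAtMost {n = zero}  (0∷ zp) = lead zp
AllZero⇒DegreeAtMost {n = suc n} (0∷ zp) = 0 ∷ AllZero⇒DegreeAtMost zp

HasDegree⇒DegreeAtMost : ∀ {p n} → HasDegree p n → DegreeAtMost p n
HasDegree⇒DegreeAtMost (lead zp) = lead zp
HasDegree⇒DegreeAtMost (a ∷ hd)  = a ∷ HasDegree⇒DegreeAtMost hd

DegreeAtMost-mono : ∀ {p m n} → m ≤ n → DegreeAtMost p m → DegreeAtMost p n
DegreeAtMost-mono               _         []        = []
DegreeAtMost-mono {n = zero}    z≤n       (lead zp) = lead zp
DegreeAtMost-mono {n = suc n}   z≤n       (lead zp) = _ ∷ AllZero⇒DegreeAtMost zp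
DegreeAtMost-mono               (s≤s m≤n) (a ∷ dp)  = a ∷ DegreeAtMost-mono m≤n dp

DegreeAtMost-scale : ∀ c {p n} → DegreeAtMost p n → DegreeAtMost (scale c p) n
DegreeAtMost-scale c []        = []
DegreeAtMost-scale c (lead zp) = lead (AllZero-scale c zp)
DegreeAtMost-scale c (a ∷ dp)  = (c * a) ∷ DegreeAtMost-scale c dp

HasDegree-scale : ∀ c {p n} → HasDegree p n → HasDegree (scale (suc c) p) n
HasDegree-scale c (lead zp) = lead (AllZero-scale (suc c) zp)
HasDegree-scale c (a ∷ hd)  = (suc c * a) ∷ HasDegree-scale c hd

-- q may have degree n as well: over ℕ leading coefficients cannot cancel.
HasDegree-⊕ : ∀ {p q n} → HasDegree p n → DegreeAtMost q n → HasDegree (p ⊕ q) n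
HasDegree-⊕ (lead zp) []        = lead zp
HasDegree-⊕ (lead zp) (lead zq) = lead (AllZero-⊕ zp zq)
HasDegree-⊕ (a ∷ hp)  []        = a ∷ hp
HasDegree-⊕ (a ∷ hp)  (b ∷ dq)  = (a + b) ∷ HasDegree-⊕ hp dq

HasDegree-⊗ : ∀ {p q m n} → HasDegree p m → HasDegree q n → HasDegree (p ⊗ q) (m + n)
HasDegree-⊗ {q = q} (lead {a = c} zp) hq =
  HasDegree-⊕ (HasDegree-scale c hq) (AllZero⇒DegreeAtMost (0∷ AllZero-⊗ˡ q zp))
HasDegree-⊗ {c ∷ p} {q} {suc m} {n} (c ∷ hp) hq =
  subst (λ r → HasDegree r (suc m + n)) (⊕-comm (0 ∷ (p ⊗ q)) (scale c q))
    (HasDegree-⊕ (0 ∷ HasDegree-⊗ hp hq)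
                 (DegreeAtMost-scale c (DegreeAtMost-mono (m≤n+m n (suc m)) (HasDegree⇒DegreeAtMost hq))))

HasDegree-pow : ∀ {p n} e → HasDegree p n → HasDegree (pow p e) (e * n)
HasDegree-pow zero    hp = lead []
HasDegree-pow (suc e) hp = HasDegree-⊗ hp (HasDegree-pow e hp)

HasDegree-xpow : ∀ k → HasDegree (xpow k) k
HasDegree-xpow zero    = lead []
HasDegree-xpow (suc k) = 0 ∷ HasDegree-xpow k

HasDegree-1+xpow : ∀ k → HasDegree ([ 1 ] ⊕ xpow k) k
HasDegree-1+xpow zero    = lead []
HasDegree-1+xpow (suc k) = 1 ∷ HasDegree-xpow k

sumBelow-peel : ∀ n f → sumBelow (suc n) f ≡ f 0 + sumBelow n (f ∘ suc)
sumBelow-peel zero    f = +-comm 0 (f 0)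
sumBelow-peel (suc n) f = trans (cong (_+ f (suc n)) (sumBelow-peel n f)) (+-assoc (f 0) _ _)

sumBelow-cong : ∀ n {f g : ℕ → ℕ} → (∀ i → i < n → f i ≡ g i) → sumBelow n f ≡ sumBelow n g
sumBelow-cong zero    f≗g = refl
sumBelow-cong (suc n) f≗g = cong₂ _+_ (sumBelow-cong n (λ i i<n → f≗g i (m<n⇒m<1+n i<n))) (f≗g n ≤-refl)

sumBelow-distrib-+ : ∀ n (f g : ℕ → ℕ) → sumBelow n (λ i → f i + g i) ≡ sumBelow n f + sumBelow n g
sumBelow-distrib-+ zero    f g = refl
sumBelow-distrib-+ (suc n) f g rewrite sumBelow-distrib-+ n f g =
  +-interchange (sumBelow n f) (sumBelow n g) (f n) (g n)

sumBelow-distribˡ-* : ∀ n c (f : ℕ → ℕ) → sumBelow n (λ i → c * f i) ≡ c * sumBelow n f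
sumBelow-distribˡ-* zero    c f = sym (*-zeroʳ c)
sumBelow-distribˡ-* (suc n) c f rewrite sumBelow-distribˡ-* n c f = sym (*-distribˡ-+ c (sumBelow n f) (f n))

term≤sumBelow : ∀ n (f : ℕ → ℕ) {i} → i < n → f i ≤ sumBelow n f
term≤sumBelow (suc n) f i<1+n with m≤n⇒m<n∨m≡n (s≤s⁻¹ i<1+n)
... | inj₁ i<n  = ≤-trans (term≤sumBelow n f i<n) (m≤m+n _ _)
... | inj₂ refl = m≤n+m _ _

HasDegree-foldr-⊗ : ∀ {f : ℕ → Poly} {g : ℕ → ℕ} → (∀ i → HasDegree (f i) (g i)) →
  ∀ n h → HasDegree (foldr (λ i acc → f i ⊗ acc) [ 1 ] (applyUpTo h n)) (sumBelow n (g ∘ h))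
HasDegree-foldr-⊗         hf zero    h = lead []
HasDegree-foldr-⊗ {g = g} hf (suc n) h = subst (HasDegree _) (sym (sumBelow-peel n (g ∘ h)))
  (HasDegree-⊗ (hf (h 0)) (HasDegree-foldr-⊗ hf n (h ∘ suc)))

HasDegree-sum : ∀ {ps n} → ps ≢ [] → All (λ p → HasDegree p n) ps → HasDegree (foldr _⊕_ [] ps) n
HasDegree-sum ps≢[] []                 = ⊥-elim (ps≢[] refl)
HasDegree-sum _     (hp ∷ [])          = subst (λ r → HasDegree r _) (sym (⊕-identityʳ _)) hp
HasDegree-sum _     (hp ∷ hps@(_ ∷ _)) = HasDegree-⊕ hp (HasDegree⇒DegreeAtMost (HasDegree-sum (λ ()) hps))

map-≢[] : ∀ {A B : Set} {f : A → B} {xs} → xs ≢ [] → map f xs ≢ []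
map-≢[] {xs = []}    xs≢[] = λ _ → xs≢[] refl
map-≢[] {xs = _ ∷ _} _     = λ ()

m*n≤o⇒m≤o/n : ∀ m n {o} .{{_ : NonZero n}} → m * n ≤ o → m ≤ o / n
m*n≤o⇒m≤o/n m n {o} mn≤o = subst (_≤ o / n) (m*n/n≡m m n) (/-monoˡ-≤ n mn≤o)

/2^-suc : ∀ n i → n /2^ suc i ≡ (n / 2) /2^ i
/2^-suc n i = sym (m/n/o≡m/[n*o] n 2 (2 ^ i) {{_}} {{m^n≢0 2 i}} {{m^n≢0 2 (suc i)}})

n/2≡⌊n/2⌋ : ∀ n → n / 2 ≡ ⌊ n /2⌋
n/2≡⌊n/2⌋ zero          = refl
n/2≡⌊n/2⌋ (suc zero)    = refl
n/2≡⌊n/2⌋ (suc (suc n)) = trans (m/n≡1+[m∸n]/n {suc (suc n)} {2} (s≤s (s≤s z≤n))) (cong suc (n/2≡⌊n/2⌋ n))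

2*n/2≡n : ∀ n → 2 * n / 2 ≡ n
2*n/2≡n n = trans (cong (_/ 2) (*-comm 2 n)) (m*n/n≡m n 2)

[1+2*n]/2≡n : ∀ n → suc (2 * n) / 2 ≡ n
[1+2*n]/2≡n n = trans (n/2≡⌊n/2⌋ (suc (2 * n))) (⌊1+2*n/2⌋≡n n)
  where
  ⌊1+2*n/2⌋≡n : ∀ n → ⌊ suc (2 * n) /2⌋ ≡ n
  ⌊1+2*n/2⌋≡n zero    = refl
  ⌊1+2*n/2⌋≡n (suc n) = cong suc (trans (cong ⌊_/2⌋ (+-suc n (n + 0))) (⌊1+2*n/2⌋≡n n))

⌊log₂n⌋≡1+⌊log₂[n/2]⌋ : ∀ {n} → 2 ≤ n → ⌊log₂ n ⌋ ≡ suc ⌊log₂ (n / 2) ⌋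
⌊log₂n⌋≡1+⌊log₂[n/2]⌋ {n} 2≤n rewrite n/2≡⌊n/2⌋ n | ⌊log₂⌊n/2⌋⌋≡⌊log₂n⌋∸1 n =
  sym (m+[n∸m]≡n (⌊log₂⌋-mono-≤ 2≤n))

n<2^n : ∀ n → n < 2 ^ n
n<2^n zero    = s≤s z≤n
n<2^n (suc n) = subst (suc n <_) (cong (2 ^ n +_) (sym (+-identityʳ (2 ^ n))))
  (+-mono-≤ (m^n>0 2 n) (n<2^n n))

n<2^[1+N]⇒n/2<2^N : ∀ {n} N → n < 2 ^ suc N → n / 2 < 2 ^ N
n<2^[1+N]⇒n/2<2^N {n} N n<2ᴺ⁺¹ = m<n*o⇒m/o<n (subst (n <_) (*-comm 2 (2 ^ N)) n<2ᴺ⁺¹)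

mult-++ˡ : ∀ xs ys {i} → i < length xs → mult (xs ++ ys) i ≡ mult xs i
mult-++ˡ (x ∷ xs) ys {zero}  _         = refl
mult-++ˡ (x ∷ xs) ys {suc i} (s≤s i<n) = mult-++ˡ xs ys i<n

mult-++ʳ : ∀ xs ys → mult (xs ++ ys) (length xs) ≡ mult ys 0
mult-++ʳ []       ys = refl
mult-++ʳ (x ∷ xs) ys = mult-++ʳ xs ys

IsBinaryPartition : ℕ → ℕ → List ℕ → Set
IsBinaryPartition k r l = length l ≡ suc k × sumBelow (suc k) (λ i → mult l i * 2 ^ i) ≡ r

IsBinaryPartition-snoc : ∀ {k r c l} → c * 2 ^ suc k ≤ r →
  IsBinaryPartition k (r ∸ c * 2 ^ suc k) l → IsBinaryPartition (suc k) r (l ++ [ c ])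
IsBinaryPartition-snoc {k} {r} {c} {l} c2ᵏ⁺¹≤r (len , sum≡) = len′ , sum≡′
  where
  open ≡-Reasoning
  len′ : length (l ++ [ c ]) ≡ suc (suc k)
  len′ = trans (length-++ l) (trans (cong (_+ 1) len) (+-comm (suc k) 1))
  sum≡′ : sumBelow (suc (suc k)) (λ i → mult (l ++ [ c ]) i * 2 ^ i) ≡ r
  sum≡′ = begin
    sumBelow (suc k) (λ i → mult (l ++ [ c ]) i * 2 ^ i) + mult (l ++ [ c ]) (suc k) * 2 ^ suc k
      ≡⟨ cong₂ _+_ (sumBelow-cong (suc k) (λ i i<n → cong (_* 2 ^ i) (mult-++ˡ l [ c ] (subst (i <_) (sym len) i<n))))
                   (cong (λ j → mult (l ++ [ c ]) j * 2 ^ suc k) (sym len)) ⟩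
    sumBelow (suc k) (λ i → mult l i * 2 ^ i) + mult (l ++ [ c ]) (length l) * 2 ^ suc k
      ≡⟨ cong₂ _+_ sum≡ (cong (_* 2 ^ suc k) (mult-++ʳ l [ c ])) ⟩
    (r ∸ c * 2 ^ suc k) + c * 2 ^ suc k
      ≡⟨ m∸n+n≡m c2ᵏ⁺¹≤r ⟩
    r ∎

bp-sound : ∀ k r → All (IsBinaryPartition k r) (bp k r)
bp-sound zero    r = (refl , cong (0 +_) (*-identityʳ r)) ∷ []
bp-sound (suc k) r = concat⁺ (map⁺ (applyUpTo⁺₁ id _ λ {c} c≤q →
  gmap⁺ (λ {l} → IsBinaryPartition-snoc {c = c} {l} (c2ᵏ⁺¹≤r (s≤s⁻¹ c≤q))) (bp-sound k (r ∸ c * 2 ^ suc k))))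
  where
  c2ᵏ⁺¹≤r : ∀ {c} → c ≤ r /2^ suc k → c * 2 ^ suc k ≤ r
  c2ᵏ⁺¹≤r c≤q = ≤-trans (*-monoˡ-≤ (2 ^ suc k) c≤q) (m/n*n≤m r (2 ^ suc k) {{m^n≢0 2 (suc k)}})

bp-nonempty : ∀ k r → bp k r ≢ []
bp-nonempty zero    r ()
bp-nonempty (suc k) r with bp k r | bp-nonempty k r
... | []    | []≢[] = λ _ → []≢[] refl
... | _ ∷ _ | _     = λ ()

floorSum : ℕ → ℕ
floorSum m = sumBelow (suc ⌊log₂ m ⌋) (λ i → m /2^ i * 2 ^ i)

floorSum-peel : ∀ m → floorSum m ≡ m + sumBelow ⌊log₂ m ⌋ (λ i → m /2^ suc i * 2 ^ suc i)
floorSum-peel m = trans (sumBelow-peel ⌊log₂ m ⌋ (λ i → m /2^ i * 2 ^ i))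
  (cong (_+ sumBelow ⌊log₂ m ⌋ (λ i → m /2^ suc i * 2 ^ suc i)) (trans (*-identityʳ (m / 1)) (n/1≡n m)))

h𝓑-degree : ℕ → List ℕ → ℕ
h𝓑-degree m l = sumBelow (suc ⌊log₂ m ⌋) (λ i → (m /2^ i ∸ mult l i) * 2 ^ i)

h𝓑-HasDegree : ∀ m l → HasDegree (h𝓑 m l) (h𝓑-degree m l)
h𝓑-HasDegree m l = HasDegree-foldr-⊗
  (λ i → HasDegree-pow (m /2^ i ∸ mult l i) (HasDegree-1+xpow (2 ^ i))) (suc ⌊log₂ m ⌋) id

h𝓑-degree+m≡floorSum : ∀ {m l} → IsBinaryPartition ⌊log₂ m ⌋ m l → h𝓑-degree m l + m ≡ floorSum m
h𝓑-degree+m≡floorSum {m} {l} (_ , sum≡) = begin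
  h𝓑-degree m l + m
    ≡⟨ cong (h𝓑-degree m l +_) (sym sum≡) ⟩
  h𝓑-degree m l + sumBelow (suc K) (λ i → mult l i * 2 ^ i)
    ≡⟨ sym (sumBelow-distrib-+ (suc K) _ _) ⟩
  sumBelow (suc K) (λ i → (m /2^ i ∸ mult l i) * 2 ^ i + mult l i * 2 ^ i)
    ≡⟨ sumBelow-cong (suc K) recombine ⟩
  floorSum m ∎
  where
  open ≡-Reasoning
  K = ⌊log₂ m ⌋
  mult≤ : ∀ {i} → i < suc K → mult l i ≤ m /2^ i
  mult≤ {i} i<n = m*n≤o⇒m≤o/n (mult l i) (2 ^ i) {{m^n≢0 2 i}}
    (subst (mult l i * 2 ^ i ≤_) sum≡ (term≤sumBelow (suc K) (λ j → mult l j * 2 ^ j) i<n))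
  recombine : ∀ i → i < suc K → (m /2^ i ∸ mult l i) * 2 ^ i + mult l i * 2 ^ i ≡ m /2^ i * 2 ^ i
  recombine i i<n = trans (sym (*-distribʳ-+ (2 ^ i) (m /2^ i ∸ mult l i) (mult l i)))
                          (cong (_* 2 ^ i) (m∸n+n≡m (mult≤ i<n)))

d+m≡floorSum : ∀ {m} → 1 ≤ m → d m + m ≡ floorSum m
d+m≡floorSum {M@(suc m)} _ = trans (cong (_+ M) (HasDegree⇒deg≡ num𝓑-HasDegree)) (m∸n+n≡m M≤floorSum)
  where
  h𝓑-degree≡ : ∀ {l} → IsBinaryPartition ⌊log₂ M ⌋ M l → h𝓑-degree M l ≡ floorSum M ∸ M
  h𝓑-degree≡ {l} bl =
    trans (sym (m+n∸n≡m (h𝓑-degree M l) M)) (cong (_∸ M) (h𝓑-degree+m≡floorSum {M} {l} bl))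
  num𝓑-HasDegree : HasDegree (num𝓑 M) (floorSum M ∸ M)
  num𝓑-HasDegree = HasDegree-sum (map-≢[] (bp-nonempty ⌊log₂ M ⌋ M))
    (gmap⁺ (λ {l} bl → subst (HasDegree (h𝓑 M l)) (h𝓑-degree≡ {l} bl) (h𝓑-HasDegree M l))
           (bp-sound ⌊log₂ M ⌋ M))
  M≤floorSum : M ≤ floorSum M
  M≤floorSum = subst (M ≤_) (sym (floorSum-peel M)) (m≤m+n M _)

floorSum-half : ∀ {n} → 2 ≤ n → floorSum n ≡ n + 2 * floorSum (n / 2)
floorSum-half {n} 2≤n = begin
  floorSum n
    ≡⟨ floorSum-peel n ⟩
  n + sumBelow ⌊log₂ n ⌋ (λ i → n /2^ suc i * 2 ^ suc i)
    ≡⟨ cong (λ K → n + sumBelow K (λ i → n /2^ suc i * 2 ^ suc i)) (⌊log₂n⌋≡1+⌊log₂[n/2]⌋ 2≤n) ⟩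
  n + sumBelow (suc L) (λ i → n /2^ suc i * 2 ^ suc i)
    ≡⟨ cong (n +_) (sumBelow-cong (suc L) (λ i _ → halve i)) ⟩
  n + sumBelow (suc L) (λ i → 2 * ((n / 2) /2^ i * 2 ^ i))
    ≡⟨ cong (n +_) (sumBelow-distribˡ-* (suc L) 2 (λ i → (n / 2) /2^ i * 2 ^ i)) ⟩
  n + 2 * floorSum (n / 2) ∎
  where
  open ≡-Reasoning
  L = ⌊log₂ (n / 2) ⌋
  halve : ∀ i → n /2^ suc i * 2 ^ suc i ≡ 2 * ((n / 2) /2^ i * 2 ^ i)
  halve i = trans (cong (_* 2 ^ suc i) (/2^-suc n i)) (x∙yz≈y∙xz ((n / 2) /2^ i) 2 (2 ^ i))

d-half : ∀ n → d n ≡ 2 * (d (n / 2) + n / 2)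
d-half zero            = refl
d-half (suc zero)      = refl
d-half n@(suc (suc _)) = +-cancelʳ-≡ n _ _ (begin
  d n + n                     ≡⟨ d+m≡floorSum (s≤s z≤n) ⟩
  floorSum n                  ≡⟨ floorSum-half 2≤n ⟩
  n + 2 * floorSum (n / 2)    ≡⟨ cong (λ x → n + 2 * x) (sym (d+m≡floorSum (m≥n⇒m/n>0 2≤n))) ⟩
  n + 2 * (d (n / 2) + n / 2) ≡⟨ +-comm n _ ⟩
  2 * (d (n / 2) + n / 2) + n ∎)
  where
  open ≡-Reasoning
  2≤n : 2 ≤ n
  2≤n = s≤s (s≤s z≤n)

d-double : ∀ n → d (2 * n) ≡ 2 * (d n + n)
d-double n = trans (d-half (2 * n)) (cong (λ h → 2 * (d h + h)) (2*n/2≡n n))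

d-double+1 : ∀ n → d (suc (2 * n)) ≡ 2 * (d n + n)
d-double+1 n = trans (d-half (suc (2 * n))) (cong (λ h → 2 * (d h + h)) ([1+2*n]/2≡n n))

d[1+2*n]≡d[2*n] : ∀ n → d (suc (2 * n)) ≡ d (2 * n)
d[1+2*n]≡d[2*n] n = trans (d-double+1 n) (sym (d-double n))

bit-suc : ∀ n i → bit n (suc i) ≡ bit (n / 2) i
bit-suc n i = cong (_% 2) (/2^-suc n i)

bitSum : ℕ → ℕ → ℕ
bitSum N n = sumBelow N (λ i → bit n i * 2 ^ i)

weightedBitSum : ℕ → ℕ → ℕ
weightedBitSum N n = sumBelow N (λ i → i * bit n i * 2 ^ i)

bitSum-suc : ∀ N n → bitSum (suc N) n ≡ n % 2 + 2 * bitSum N (n / 2)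
bitSum-suc N n = trans (sumBelow-peel N (λ i → bit n i * 2 ^ i)) (cong₂ _+_
  (trans (*-identityʳ (bit n 0)) (cong (_% 2) (n/1≡n n)))
  (trans (sumBelow-cong N (λ i _ → shift i)) (sumBelow-distribˡ-* N 2 (λ i → bit (n / 2) i * 2 ^ i))))
  where
  shift : ∀ i → bit n (suc i) * 2 ^ suc i ≡ 2 * (bit (n / 2) i * 2 ^ i)
  shift i = trans (cong (_* 2 ^ suc i) (bit-suc n i)) (x∙yz≈y∙xz (bit (n / 2) i) 2 (2 ^ i))

bitSum≡ : ∀ N {n} → n < 2 ^ N → bitSum N n ≡ n
bitSum≡ zero        (s≤s z≤n) = refl
bitSum≡ (suc N) {n} n<2ᴺ⁺¹    = begin
  bitSum (suc N) n             ≡⟨ bitSum-suc N n ⟩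
  n % 2 + 2 * bitSum N (n / 2) ≡⟨ cong (λ x → n % 2 + 2 * x) (bitSum≡ N (n<2^[1+N]⇒n/2<2^N N n<2ᴺ⁺¹)) ⟩
  n % 2 + 2 * (n / 2)          ≡⟨ cong (n % 2 +_) (*-comm 2 (n / 2)) ⟩
  n % 2 + n / 2 * 2            ≡⟨ sym (m≡m%n+[m/n]*n n 2) ⟩
  n ∎
  where open ≡-Reasoning

weightedBitSum-suc : ∀ N n → weightedBitSum (suc N) n ≡ 2 * (weightedBitSum N (n / 2) + bitSum N (n / 2))
weightedBitSum-suc N n = begin
  weightedBitSum (suc N) n
    ≡⟨ sumBelow-peel N (λ i → i * bit n i * 2 ^ i) ⟩
  sumBelow N (λ i → suc i * bit n (suc i) * 2 ^ suc i)
    ≡⟨ sumBelow-cong N (λ i _ → shift i) ⟩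
  sumBelow N (λ i → 2 * (i * bit h i * 2 ^ i + bit h i * 2 ^ i))
    ≡⟨ sumBelow-distribˡ-* N 2 (λ i → i * bit h i * 2 ^ i + bit h i * 2 ^ i) ⟩
  2 * sumBelow N (λ i → i * bit h i * 2 ^ i + bit h i * 2 ^ i)
    ≡⟨ cong (2 *_) (sumBelow-distrib-+ N (λ i → i * bit h i * 2 ^ i) (λ i → bit h i * 2 ^ i)) ⟩
  2 * (weightedBitSum N h + bitSum N h) ∎
  where
  open ≡-Reasoning
  h = n / 2
  expand : ∀ b i p → suc i * b * (2 * p) ≡ 2 * (i * b * p + b * p)
  expand = solve-∀
  shift : ∀ i → suc i * bit n (suc i) * 2 ^ suc i ≡ 2 * (i * bit h i * 2 ^ i + bit h i * 2 ^ i)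
  shift i = trans (cong (λ b → suc i * b * 2 ^ suc i) (bit-suc n i)) (expand (bit h i) i (2 ^ i))

d≡weightedBitSum : ∀ N {n} → n < 2 ^ N → d n ≡ weightedBitSum N n
d≡weightedBitSum zero        (s≤s z≤n) = refl
d≡weightedBitSum (suc N) {n} n<2ᴺ⁺¹    = begin
  d n
    ≡⟨ d-half n ⟩
  2 * (d h + h)
    ≡⟨ cong₂ (λ a b → 2 * (a + b)) (d≡weightedBitSum N h<2ᴺ) (sym (bitSum≡ N h<2ᴺ)) ⟩
  2 * (weightedBitSum N h + bitSum N h)
    ≡⟨ sym (weightedBitSum-suc N n) ⟩
  weightedBitSum (suc N) n ∎
  where
  open ≡-Reasoning
  h = n / 2
  h<2ᴺ : h < 2 ^ N
  h<2ᴺ = n<2^[1+N]⇒n/2<2^N N n<2ᴺ⁺¹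

val₂-aux-odd : ∀ f n → suc n % 2 ≡ 1 → val₂-aux (suc f) (suc n) ≡ 0
val₂-aux-odd f n odd rewrite odd = refl

val₂-aux-even : ∀ f n → suc n % 2 ≡ 0 → val₂-aux (suc f) (suc n) ≡ suc (val₂-aux f (suc n / 2))
val₂-aux-even f n even rewrite even = refl

val₂-aux-fuel : ∀ f g n → n ≤ f → n ≤ g → val₂-aux f n ≡ val₂-aux g n
val₂-aux-fuel zero    zero    zero    _         _         = refl
val₂-aux-fuel zero    (suc g) zero    _         _         = refl
val₂-aux-fuel (suc f) zero    zero    _         _         = refl
val₂-aux-fuel (suc f) (suc g) zero    _         _         = refl
val₂-aux-fuel (suc f) (suc g) (suc n) (s≤s n≤f) (s≤s n≤g) =
  cong (λ v → if ⌊ suc n % 2 ≟ 0 ⌋ then suc v else 0)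
       (val₂-aux-fuel f g (suc n / 2) (≤-trans half≤n n≤f) (≤-trans half≤n n≤g))
  where
  half≤n : suc n / 2 ≤ n
  half≤n = s≤s⁻¹ (m/n<m (suc n) 2 (s≤s (s≤s z≤n)))

val₂-odd : ∀ n → val₂ (suc (2 * n)) ≡ 0
val₂-odd n = val₂-aux-odd (2 * n) (2 * n)
  (trans (cong (λ k → suc k % 2) (*-comm 2 n)) ([m+kn]%n≡m%n 1 n 2))

val₂-double : ∀ n → val₂ (2 * suc n) ≡ suc (val₂ (suc n))
val₂-double n = trans
  (val₂-aux-even F F (trans (cong (_% 2) (*-comm 2 (suc n))) (m*n%n≡0 (suc n) 2)))
  (cong suc (trans (cong (val₂-aux F) (2*n/2≡n (suc n))) (val₂-aux-fuel F (suc n) (suc n) 1+n≤F ≤-refl)))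
  where
  F = n + suc (n + 0)
  1+n≤F : suc n ≤ F
  1+n≤F = subst (suc n ≤_) (sym (+-suc n (n + 0))) (s≤s (m≤m+n n (n + 0)))

-- Induction on the binary representation of n, since the case n = 1 + 2m rests on the case m.
d-suc : ∀ n → d (suc n) + 2 ≡ d n + 2 ^ suc (val₂ (suc n))
d-suc n = subst P (toℕ-fromℕ n) (d-sucᵇ (fromℕ n))
  where
  P : ℕ → Set
  P n = d (suc n) + 2 ≡ d n + 2 ^ suc (val₂ (suc n))
  d-sucᵇ : ∀ b → P (toℕ b)
  d-sucᵇ zero     = refl
  d-sucᵇ 2[1+ b ] = cong₂ _+_ (d[1+2*n]≡d[2*n] (suc (toℕ b)))
                               (cong (λ v → 2 ^ suc v) (sym (val₂-odd (suc (toℕ b)))))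
  d-sucᵇ 1+[2 b ] = begin
    d (suc (suc (2 * m))) + 2           ≡⟨ cong (λ k → d k + 2) 2+2m≡2[1+m] ⟩
    d (2 * suc m) + 2                   ≡⟨ cong (_+ 2) (d-double (suc m)) ⟩
    2 * (d (suc m) + suc m) + 2         ≡⟨ regroup (d (suc m)) m ⟩
    2 * (d (suc m) + 2) + 2 * m         ≡⟨ cong (λ x → 2 * x + 2 * m) (d-sucᵇ b) ⟩
    2 * (d m + 2 ^ suc v) + 2 * m       ≡⟨ swap (d m) (2 ^ suc v) m ⟩
    2 * (d m + m) + 2 ^ suc (suc v)
      ≡⟨ cong₂ _+_ (sym (d-double+1 m)) (cong (λ v → 2 ^ suc v) (sym (val₂-double m))) ⟩
    d (suc (2 * m)) + 2 ^ suc (val₂ (2 * suc m))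
      ≡⟨ cong (λ k → d (suc (2 * m)) + 2 ^ suc (val₂ k)) (sym 2+2m≡2[1+m]) ⟩
    d (suc (2 * m)) + 2 ^ suc (val₂ (suc (suc (2 * m)))) ∎
    where
    open ≡-Reasoning
    m = toℕ b
    v = val₂ (suc m)
    2+2m≡2[1+m] : suc (suc (2 * m)) ≡ 2 * suc m
    2+2m≡2[1+m] = cong suc (sym (+-suc m (m + 0)))
    regroup : ∀ a m → 2 * (a + suc m) + 2 ≡ 2 * (a + 2) + 2 * m
    regroup = solve-∀
    swap : ∀ a p m → 2 * (a + p) + 2 * m ≡ 2 * (a + m) + 2 * p
    swap = solve-∀

d-even : ∀ n → 2 ∣ n → d n + 2 ≡ d (n ∸ 2) + 2 ^ suc (val₂ n)
d-even .(0 * 2)     (divides zero    refl) = refl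
d-even .(suc i * 2) (divides (suc i) refl) =
  trans (d-suc (suc (i * 2))) (cong (_+ 2 ^ suc (val₂ (suc i * 2))) d[1+2i]≡d[2i])
  where
  d[1+2i]≡d[2i] : d (suc (i * 2)) ≡ d (i * 2)
  d[1+2i]≡d[2i] = subst (λ k → d (suc k) ≡ d k) (*-comm 2 i) (d[1+2*n]≡d[2*n] i)

-- All three identities hold without the lower bounds on n.
proposition4p14 :
    (∀ n → 2 ≤ n → 2 ∣ n → d n + 2 ≡ d (n ∸ 2) + 2 ^ suc (val₂ n))
    × (∀ n → 2 ≤ n → d n ≡ 2 * (d (n / 2) + n / 2))
    × (∀ n → 1 ≤ n → d n ≡ sumBelow (suc n) (λ i → i * bit n i * 2 ^ i))
proposition4p14 =
    (λ n _ → d-even n)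
  , (λ n _ → d-half n)
  , (λ n _ → d≡weightedBitSum (suc n) (<-trans (n<1+n n) (n<2^n (suc n))))
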